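{- Let $\{m(i,j)\}_{i,j\ge1}$ be the integer matrix defined by (with $m(i,j)=0$ for $i\le0$): $m(1,1)=9$, $m(2,1)=6$, $m(3,1)=1$, $m(i,1)=0$ for $i\ge4$, and for $j\ge2$, $m(i,j)=27m(i-1,j-1)+9m(i-2,j-1)+m(i-3,j-1)$. Then for all integers $i\ge1$ and $j\ge1$, $$\nu_3(m(i,j))\ge\left\lfloor\frac{9j-3i-1}{2}\right\rfloor.$$
   Context: $\nu_3(n)$ denotes the exponent of the highest power of $3$ dividing the integer $n$, with the convention $\nu_3(0)=\infty$. -}

module Defs where

open import Data.Nat using (ℕ; zero; suc; _+_; _*_; _∸_; _^_)
open import Data.Integer using (ℤ; +_; _≤_)
import Data.Nat.Divisibility as ℕD

-- The matrix m(i,j), indices i,j ≥ 1 (index 0 / i ≤ 0 gives 0; j = 0 unused).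
-- m(1,1)=9, m(2,1)=6, m(3,1)=1, m(i,1)=0 for i ≥ 4,
-- m(i,j) = 27 m(i-1,j-1) + 9 m(i-2,j-1) + m(i-3,j-1) for j ≥ 2.
-- Entries are nonnegative, so ℕ-valued.
m : ℕ → ℕ → ℕ
m zero _ = 0
m (suc i) zero = 0
m (suc zero) (suc zero) = 9
m (suc (suc zero)) (suc zero) = 6
m (suc (suc (suc zero))) (suc zero) = 1
m (suc (suc (suc (suc _)))) (suc zero) = 0
m (suc i) (suc (suc j)) =
  27 * m i (suc j) + 9 * m (i ∸ 1) (suc j) + m (i ∸ 2) (suc j)

-- ν₃(n) ≥ k  (with ν₃(0) = ∞), for an integer bound k:
-- every power 3^e with e ≤ k divides n.
ν₃≥ : ℕ → ℤ → Set
ν₃≥ n k = ∀ (e : ℕ) → + e ≤ k → (3 ^ e) ℕD.∣ n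

-- Put w(i,j) = 9j − 3i − 1 and prove 2·ν₃(m(i,j)) ≥ w(i,j) by induction on j; halving then
-- gives the floor bound. In the recurrence the term
-- 3^(3−k)·m(i−1−k, j−1), k = 0, 1, 2, has 2·ν₃ ≥ 2(3−k) + w(i−1−k, j−1) = w(i,j) + k.
module Submission where

open import Defs
open import Data.Nat using (ℕ; _≥_)
open import Data.Integer using (ℤ; +_; _-_; _*_; _/ℕ_)
open import Data.Nat as ℕ using (zero; suc; _^_; _∸_)
import Data.Nat.Properties as ℕ
open import Data.Integer as ℤ using (_+_; _≤_; _<_; -_; +≤+; +<+; -<+)
import Data.Integer.Properties as ℤ
open import Data.Integer.DivMod using ([n/ℕd]*d≤n)
open import Data.Integer.Tactic.RingSolver using (solve-∀)
open import Data.Nat.Divisibility using (_∣_; _∣0; 1∣_; ∣m∣n⇒∣m+n; *-monoʳ-∣)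
open import Data.Empty using (⊥-elim)
open import Relation.Binary.PropositionalEquality using (_≡_; refl; sym; subst)

+-cancelˡ-≤ : ∀ i {j k} → i + j ≤ i + k → j ≤ k
+-cancelˡ-≤ i {j} {k} i+j≤i+k = begin
  j               ≡⟨ sym (-i+[i+j]≡j i j) ⟩
  - i + (i + j)   ≤⟨ ℤ.+-monoʳ-≤ (- i) i+j≤i+k ⟩
  - i + (i + k)   ≡⟨ -i+[i+j]≡j i k ⟩
  k               ∎
  where
  open ℤ.≤-Reasoning
  -i+[i+j]≡j : ∀ i j → - i + (i + j) ≡ j
  -i+[i+j]≡j = solve-∀

Twiceν≥ : ℕ → ℕ → ℤ → Set
Twiceν≥ p x κ = ∀ e → + 2 * + e ≤ κ → p ^ e ∣ x

module _ {p : ℕ} where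

  twiceν≥-0 : ∀ {κ} → Twiceν≥ p 0 κ
  twiceν≥-0 e _ = (p ^ e) ∣0

  twiceν≥-<2 : ∀ {x κ} → κ < + 2 → Twiceν≥ p x κ
  twiceν≥-<2 κ<2 zero _ = 1∣ _
  twiceν≥-<2 κ<2 (suc e) 2e≤κ = ⊥-elim (ℤ.<⇒≱ κ<2 (ℤ.≤-trans (+≤+ 2≤2+2e) 2e≤κ))
    where 2≤2+2e : 2 ℕ.≤ 2 ℕ.* suc e
          2≤2+2e = ℕ.*-monoʳ-≤ 2 (ℕ.s≤s ℕ.z≤n)

  twiceν≥-mono : ∀ {x κ κ′} → κ′ ≤ κ → Twiceν≥ p x κ → Twiceν≥ p x κ′
  twiceν≥-mono κ′≤κ ν e h = ν e (ℤ.≤-trans h κ′≤κ)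

  twiceν≥-+ : ∀ {x y κ} → Twiceν≥ p x κ → Twiceν≥ p y κ → Twiceν≥ p (x ℕ.+ y) κ
  twiceν≥-+ νx νy e h = ∣m∣n⇒∣m+n (νx e h) (νy e h)

  twiceν≥-* : ∀ {x κ} → Twiceν≥ p x κ → Twiceν≥ p (p ℕ.* x) (+ 2 + κ)
  twiceν≥-* ν zero _ = 1∣ _
  twiceν≥-* {κ = κ} ν (suc e) h = *-monoʳ-∣ p (ν e (+-cancelˡ-≤ (+ 2) h′))
    where
    2[1+e]≡2+2e : ∀ e → + 2 * (+ 1 + e) ≡ + 2 + + 2 * e
    2[1+e]≡2+2e = solve-∀
    h′ : + 2 + + 2 * + e ≤ + 2 + κ
    h′ = subst (_≤ + 2 + κ) (2[1+e]≡2+2e (+ e)) h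

  twiceν≥-*^ : ∀ k {x κ} → Twiceν≥ p x κ → Twiceν≥ p (p ^ k ℕ.* x) (+ 2 * + k + κ)
  twiceν≥-*^ zero {x} {κ} ν =
    subst (λ y → Twiceν≥ p y (+ 0 + κ)) (sym (ℕ.*-identityˡ x))
      (twiceν≥-mono (ℤ.≤-reflexive (ℤ.+-identityˡ κ)) ν)
  twiceν≥-*^ (suc k) {x} {κ} ν =
    subst (λ y → Twiceν≥ p y (+ 2 * + suc k + κ)) (sym (ℕ.*-assoc p (p ^ k) x))
      (twiceν≥-mono (ℤ.≤-reflexive (shift (+ k) κ)) (twiceν≥-* (twiceν≥-*^ k ν)))
    where
    shift : ∀ k κ → + 2 * (+ 1 + k) + κ ≡ + 2 + (+ 2 * k + κ)
    shift = solve-∀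

twiceν≥⇒ν₃≥ : ∀ {x κ} → Twiceν≥ 3 x κ → ν₃≥ x (κ /ℕ 2)
twiceν≥⇒ν₃≥ {κ = κ} ν e e≤κ/2 = ν e (ℤ.≤-trans 2e≤2[κ/2] ([n/ℕd]*d≤n κ 2))
  where
  2e≤2[κ/2] : + 2 * + e ≤ κ /ℕ 2 * + 2
  2e≤2[κ/2] = subst (_≤ κ /ℕ 2 * + 2) (ℤ.*-comm (+ e) (+ 2)) (ℤ.*-monoʳ-≤-nonNeg (+ 2) e≤κ/2)

weight : ℕ → ℕ → ℤ
weight i j = + 9 * + j - + 3 * + i - + 1

m-recurrence : ∀ i j → m (suc i) (suc (suc j)) ≡
  3 ^ 3 ℕ.* m i (suc j) ℕ.+ 3 ^ 2 ℕ.* m (i ∸ 1) (suc j) ℕ.+ m (i ∸ 2) (suc j)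
m-recurrence zero j = refl
m-recurrence (suc zero) j = refl
m-recurrence (suc (suc zero)) j = refl
m-recurrence (suc (suc (suc i))) j = refl

m-twiceν≥-column₀ : ∀ i → Twiceν≥ 3 (m i 0) (weight i 0)
m-twiceν≥-column₀ zero = twiceν≥-0
m-twiceν≥-column₀ (suc i) = twiceν≥-0

m-twiceν≥-column₁ : ∀ i → Twiceν≥ 3 (m i 1) (weight i 1)
m-twiceν≥-column₁ zero = twiceν≥-0
m-twiceν≥-column₁ 1 = twiceν≥-*^ 2 {x = 1} (twiceν≥-<2 (+<+ (ℕ.s≤s (ℕ.s≤s ℕ.z≤n))))
m-twiceν≥-column₁ 2 = twiceν≥-*^ 1 {x = 2} (twiceν≥-<2 (+<+ (ℕ.s≤s ℕ.z≤n)))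
m-twiceν≥-column₁ 3 = twiceν≥-<2 -<+
m-twiceν≥-column₁ (suc (suc (suc (suc i)))) = twiceν≥-0

module _ (j : ℕ) (ih : ∀ i → Twiceν≥ 3 (m i (suc j)) (weight i (suc j))) where

  m-twiceν≥-∸ : ∀ k i → Twiceν≥ 3 (m (i ∸ k) (suc j)) (weight i (suc j) + + 3 * + k)
  m-twiceν≥-∸ zero i = twiceν≥-mono (ℤ.≤-reflexive (ℤ.+-identityʳ _)) (ih i)
  m-twiceν≥-∸ (suc k) zero = twiceν≥-0
  m-twiceν≥-∸ (suc k) (suc i) = twiceν≥-mono (ℤ.≤-reflexive (weight-shift (+ i) (+ suc j) (+ k))) (m-twiceν≥-∸ k i)
    where
    weight-shift : ∀ i j k → + 9 * j - + 3 * (+ 1 + i) - + 1 + + 3 * (+ 1 + k) ≡ + 9 * j - + 3 * i - + 1 + + 3 * k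
    weight-shift = solve-∀

  m-twiceν≥-step : ∀ i → Twiceν≥ 3 (m i (suc (suc j))) (weight i (suc (suc j)))
  m-twiceν≥-step zero = twiceν≥-0
  m-twiceν≥-step (suc i) = subst (λ x → Twiceν≥ 3 x w′) (sym (m-recurrence i j))
    (twiceν≥-+ (twiceν≥-+ (twiceν≥-mono (ℤ.≤-reflexive (bound₀ (+ i) (+ suc j))) (twiceν≥-*^ 3 (ih i)))
                          (twiceν≥-mono w′≤bound₁ (twiceν≥-*^ 2 (m-twiceν≥-∸ 1 i))))
               (twiceν≥-mono (ℤ.≤-reflexive (bound₂ (+ i) (+ suc j))) (m-twiceν≥-∸ 2 i)))
    where
    w′ : ℤ
    w′ = weight (suc i) (suc (suc j))
    bound₀ : ∀ i j → + 9 * (+ 1 + j) - + 3 * (+ 1 + i) - + 1 ≡ + 2 * + 3 + (+ 9 * j - + 3 * i - + 1)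
    bound₀ = solve-∀
    bound₁ : ∀ i j → + 1 + (+ 9 * (+ 1 + j) - + 3 * (+ 1 + i) - + 1) ≡ + 2 * + 2 + (+ 9 * j - + 3 * i - + 1 + + 3 * + 1)
    bound₁ = solve-∀
    bound₂ : ∀ i j → + 9 * (+ 1 + j) - + 3 * (+ 1 + i) - + 1 ≡ + 9 * j - + 3 * i - + 1 + + 3 * + 2
    bound₂ = solve-∀
    w′≤bound₁ : w′ ≤ + 2 * + 2 + (weight i (suc j) + + 3 * + 1)
    w′≤bound₁ = ℤ.≤-trans (ℤ.i≤j+i w′ (+ 1)) (ℤ.≤-reflexive (bound₁ (+ i) (+ suc j)))

m-twiceν≥ : ∀ j i → Twiceν≥ 3 (m i j) (weight i j)
m-twiceν≥ zero = m-twiceν≥-column₀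
m-twiceν≥ (suc zero) = m-twiceν≥-column₁
m-twiceν≥ (suc (suc j)) = m-twiceν≥-step j (m-twiceν≥ (suc j))

lemma3p2 : ∀ (i j : ℕ) → i ≥ 1 → j ≥ 1 →
    ν₃≥ (m i j) ((+ 9 * + j - + 3 * + i - + 1) /ℕ 2)
lemma3p2 i j _ _ = twiceν≥⇒ν₃≥ (m-twiceν≥ j i)
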